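{- Let $b,n,c$ be positive integers with $2\leqslant 2b\leqslant n$, and let $\Gamma$ be an abelian group of order $2nbc$. If $\Gamma$ contains an element of order $n$, then there exists a diagonal $\mathrm{MRS}_\Gamma(n;2b;c)$. In particular, this holds if $n$ divides the exponent of $\Gamma$.
   Context: For positive integers $m,n,s,k,c$ and an abelian group $\Gamma$ of order $nkc$, an $\mathrm{MRS}_\Gamma(m,n;s,k;c)$ is a set of $c$ partially filled $m\times n$ arrays (some cells may be empty) with entries in $\Gamma$ such that every element of $\Gamma$ appears exactly once and in a unique array; in every array each row has exactly $s$ filled cells and each column exactly $k$ filled cells; and there exist $\omega,\delta\in\Gamma$ such that in every array each row sums to $\omega$ and each column sums to $\delta$. $\mathrm{MRS}_\Gamma(n;k;c)$ denotes $\mathrm{MRS}_\Gamma(n,n;k,k;c)$. For an $n\times n$ array, the diagonal $D_\ell$ ($0\leqslant\ell\leqslant n-1$) is the set of cells $(i,j)$ with $j-i\equiv\ell\pmod n$. An $\mathrm{MRS}_\Gamma(n;k;c)$ is diagonal if, in every one of its arrays, the filled cells are exactly the cells of $k$ consecutive diagonals $D_t,D_{t+1},\ldots,D_{t+k-1}$ (indices modulo $n$). -}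

module Defs where

open import Level using (Level; _⊔_)
open import Algebra.Bundles using (AbelianGroup)
open import Data.Nat using (ℕ; zero; suc; _+_; _*_; _≤_; _<_)
open import Data.Fin using (Fin; toℕ) renaming (zero to fzero; suc to fsuc)
open import Data.Bool using (Bool; true; false; if_then_else_)
open import Data.Maybe using (Maybe; just; nothing; is-just; fromMaybe)
open import Data.Product using (Σ; _×_; _,_; ∃)
open import Relation.Binary.PropositionalEquality using (_≡_)

sumℕ : (n : ℕ) → (Fin n → ℕ) → ℕ
sumℕ zero    f = 0
sumℕ (suc n) f = f fzero + sumℕ n (λ i → f (fsuc i))

countTrue : (n : ℕ) → (Fin n → Bool) → ℕ
countTrue n p = sumℕ n (λ i → if p i then 1 else 0)

-- Cell (i , j) of an n × n array lies in one of the k consecutive diagonals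
-- D_t, D_{t+1}, …, D_{t+k-1}  (D_ℓ = {(i,j) | j - i ≡ ℓ mod n}),
-- i.e. j ≡ i + t + ℓ (mod n) for some 0 ≤ ℓ < k.
InDiagonals : (n k : ℕ) (t i j : Fin n) → Set
InDiagonals n k t i j =
  Σ ℕ λ ℓ → ℓ < k × Σ ℕ λ q → toℕ i + toℕ t + ℓ ≡ toℕ j + q * n

module _ {a ℓ : Level} (G : AbelianGroup a ℓ) where
  open AbelianGroup G

  _•_ : ℕ → Carrier → Carrier
  zero  • g = ε
  suc m • g = g ∙ (m • g)

  ∑ : (n : ℕ) → (Fin n → Carrier) → Carrier
  ∑ zero    f = ε
  ∑ (suc n) f = f fzero ∙ ∑ n (λ i → f (fsuc i))

  HasOrder : ℕ → Set (a ⊔ ℓ)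
  HasOrder N = Σ (Fin N → Carrier) λ e →
    (∀ i j → e i ≈ e j → i ≡ j) × (∀ g → ∃ λ i → e i ≈ g)

  ElementOrder : Carrier → ℕ → Set ℓ
  ElementOrder g n =
    1 ≤ n × (n • g ≈ ε) × (∀ m → 1 ≤ m → m • g ≈ ε → n ≤ m)

  IsExponent : ℕ → Set (a ⊔ ℓ)
  IsExponent e =
    1 ≤ e × (∀ g → e • g ≈ ε) × (∀ m → 1 ≤ m → (∀ g → m • g ≈ ε) → e ≤ m)

  -- An MRS_Γ(m,n;s,k;c): c partially filled m × n arrays over Γ
  -- (nothing = empty cell).
  record IsMRS (m n s k c : ℕ) (A : Fin c → Fin m → Fin n → Maybe Carrier) : Set (a ⊔ ℓ) where
    field
      covers   : ∀ g → Σ (Fin c) λ x → Σ (Fin m) λ i → Σ (Fin n) λ j →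
                   Σ Carrier λ h → A x i j ≡ just h × h ≈ g
      unique   : ∀ x i j x' i' j' h h' → A x i j ≡ just h → A x' i' j' ≡ just h' →
                   h ≈ h' → (x ≡ x') × (i ≡ i') × (j ≡ j')
      rowCount : ∀ x i → countTrue n (λ j → is-just (A x i j)) ≡ s
      colCount : ∀ x j → countTrue m (λ i → is-just (A x i j)) ≡ k
      ω        : Carrier
      δ        : Carrier
      rowSum   : ∀ x i → ∑ n (λ j → fromMaybe ε (A x i j)) ≈ ω
      colSum   : ∀ x j → ∑ m (λ i → fromMaybe ε (A x i j)) ≈ δ

  MRS : (n k c : ℕ) → Set (a ⊔ ℓ)
  MRS n k c = Σ (Fin c → Fin n → Fin n → Maybe Carrier) λ A → IsMRS n n k k c A

  DiagonalMRS : (n k c : ℕ) → Set (a ⊔ ℓ)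
  DiagonalMRS n k c =
    Σ (Fin c → Fin n → Fin n → Maybe Carrier) λ A → IsMRS n n k k c A ×
      (∀ x → Σ (Fin n) λ t → ∀ i j →
         ((Σ Carrier λ h → A x i j ≡ just h) → InDiagonals n k t i j) ×
         (InDiagonals n k t i j → Σ Carrier λ h → A x i j ≡ just h))

{-# OPTIONS --safe #-}
module Submission where

-- Let g have order n and H = ⟨g⟩. The quotient G / H has even order 2 c b, so it has an element of order 2
-- (pair each x ≠ 0 with - x); hence doubling on G / H is not onto and some s is not a double. Greedily choose
-- cosets U₁, …, U_cb with Uᵢ + Uⱼ ≠ s for all i, j: together with their partners s - Uᵢ they are the 2 c b
-- cosets of H. Array x puts u + i g and its partner s - (u + i g) on the diagonals 2 p and 2 p + 1 of row i,
-- where u represents the p-th coset assigned to x. Rows then sum to b s and, since consecutive diagonals of a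
-- column pass through consecutive rows, columns sum to b (s + g); the 2 c b n entries are pairwise distinct,
-- hence exhaust G. If n divides the exponent, an element of maximal order has order equal to the exponent,
-- and a multiple of it has order n.

open import Defs
open import Level using (Level; _⊔_)
open import Algebra.Bundles using (AbelianGroup; CommutativeMonoid; Monoid)
import Algebra.Properties.Monoid.Mult as Mult
import Algebra.Properties.Monoid.Sum as Sum
open import Data.Bool using (Bool; true; false; if_then_else_)
open import Data.Empty using (⊥-elim)
open import Data.Fin using (Fin; zero; suc; toℕ; fromℕ<; combine; remQuot; splitAt; _↑ˡ_; _↑ʳ_)
import Data.Fin.Properties as Fin
open import Data.Fin.Permutation using (permutation)
import Data.List as List
open import Data.List.Membership.Propositional.Properties using (∈-allFin)
import Data.List.Relation.Unary.All as All
open import Data.Maybe using (Maybe; just; nothing; is-just; fromMaybe)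
import Data.Maybe as Maybe
open import Data.Maybe.Properties using (map-just)
open import Data.Nat
  using ( ℕ; zero; suc; pred; _+_; _*_; _≤_; _<_; _<?_; z≤n; s≤s; z<s
        ; NonZero; >-nonZero; >-nonZero⁻¹; nonTrivial⇒n>1 )
open import Data.Nat.Properties
  using ( ≤-refl; ≤-reflexive; ≤-trans; ≤-antisym; ≤-total; ≤-totalOrder; <-≤-trans; ≤-<-trans; ≮⇒≥; <⇒≱; >⇒≢; ≤∧≢⇒<
        ; 1+n≰n; n≢0⇒n>0; m<n⇒m<1+n; m≤n⇒∃[o]m+o≡n; m≤n+m; anyUpTo?
        ; +-assoc; +-comm; +-suc; +-identityʳ; +-cancelˡ-≡; +-mono-≤; +-mono-<
        ; *-comm; *-assoc; *-suc; *-identityˡ; *-monoˡ-<; *-cancelʳ-≤; m<m*n; m*n≢0; m*n≢0⇒m≢0; m*n≢0⇒n≢0; suc-pred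
        ; *-commutativeSemigroup; +-0-monoid; +-0-commutativeMonoid )
open import Algebra.Properties.CommutativeSemigroup *-commutativeSemigroup using (xy∙z≈xz∙y)
open import Data.Nat.DivMod using (_%_; _/_; _mod_; m≡m%n+[m/n]*n; m%n<n; [m+kn]%n≡m%n; m<n⇒m%n≡m)
open import Data.Nat.Divisibility
  using (_∣_; divides; _∣?_; ∣-refl; ∣-trans; 1∣_; ∣⇒≤; m∣m*n; *-monoˡ-∣; *-cancelˡ-∣; m%n≡0⇒n∣m)
open import Data.Nat.Coprimality using (Coprime; coprime?; coprime-divisor; gcd≡1⇒coprime; coprime⇒gcd≡1)
import Data.Nat.Coprimality as Coprime
open import Data.Nat.GCD using (gcd; gcd[m,n]∣m; gcd[m,n]∣n; gcd[m,n]≢0)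
open import Data.Nat.LCM using (lcm; lcm-least; gcd*lcm)
open import Data.Nat.Induction using (<-rec)
open import Data.Nat.ListAction using (product)
open import Data.Nat.Primality using (Prime; prime⇒irreducible; prime⇒nonTrivial; prime⇒nonZero)
open import Data.Nat.Primality.Factorisation using (factorise)
open import Data.Nat.Tactic.RingSolver using (solve-∀)
open import Data.Product using (Σ; ∃; ∃₂; _×_; _,_; proj₁; proj₂; map₁)
open import Data.Product.Function.NonDependent.Propositional using (_×-↔_)
open import Data.Sum using (inj₁; inj₂; [_,_])
open import Data.Vec.Functional using ([]; _∷_; _++_)
open import Function using (_∘_; id; _↔_; Inverse)
open import Function.Definitions using (Injective; StrictlySurjective; Congruent)
open import Function.Properties.Inverse using (↔-refl; ↔-trans)
open import Relation.Binary.Bundles using (Setoid)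
open import Relation.Binary.Definitions using (Decidable)
open import Relation.Binary.PropositionalEquality as ≡ using (_≡_)
open import Relation.Nullary using (¬_; yes; no; ¬?; contradiction)
import Relation.Nullary.Decidable as Dec
open import Relation.Nullary.Decidable using (_×-dec_)
open import Relation.Unary using (Pred) renaming (Decidable to Decidable₁)

least : ∀ {p} {P : Pred ℕ p} → Decidable₁ P → ∀ {B} → P B → ∃ λ m → P m × ∀ {k} → P k → m ≤ k
least {P = P} P? {B} = <-rec (λ B → P B → ∃ λ m → P m × ∀ {k} → P k → m ≤ k) below B
  where
  below : ∀ B → (∀ {A} → A < B → P A → ∃ λ m → P m × ∀ {k} → P k → m ≤ k) →
          P B → ∃ λ m → P m × ∀ {k} → P k → m ≤ k
  below B smaller PB with anyUpTo? P? B
  ... | yes (A , A<B , PA) = smaller A<B PA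
  ... | no ∄A = B , PB , λ {k} Pk → ≮⇒≥ λ k<B → ∄A (k , k<B , Pk)

remainder-unique : ∀ {n} .{{_ : NonZero n}} {a a′} q q′ → a < n → a′ < n →
                   a + q * n ≡ a′ + q′ * n → a ≡ a′
remainder-unique {n} {a} {a′} q q′ a<n a′<n eq = begin
  a                 ≡⟨ m<n⇒m%n≡m a<n ⟨
  a % n             ≡⟨ [m+kn]%n≡m%n a q n ⟨
  (a + q * n) % n   ≡⟨ ≡.cong (_% n) eq ⟩
  (a′ + q′ * n) % n ≡⟨ [m+kn]%n≡m%n a′ q′ n ⟩
  a′ % n            ≡⟨ m<n⇒m%n≡m a′<n ⟩
  a′                ∎
  where open ≡.≡-Reasoning

differences-≡ : ∀ {a b c d b′ d′} → a + b ≡ c + d → a + b′ ≡ c + d′ → b + d′ ≡ b′ + d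
differences-≡ {a} {b} {c} {d} {b′} {d′} a+b≡c+d a+b′≡c+d′ = +-cancelˡ-≡ a _ _ (begin
  a + (b + d′)  ≡⟨ +-assoc a b d′ ⟨
  a + b + d′    ≡⟨ ≡.cong (_+ d′) a+b≡c+d ⟩
  c + d + d′    ≡⟨ +-assoc c d d′ ⟩
  c + (d + d′)  ≡⟨ ≡.cong (c +_) (+-comm d d′) ⟩
  c + (d′ + d)  ≡⟨ +-assoc c d′ d ⟨
  c + d′ + d    ≡⟨ ≡.cong (_+ d) a+b′≡c+d′ ⟨
  a + b′ + d    ≡⟨ +-assoc a b′ d ⟩
  a + (b′ + d)  ∎)
  where open ≡.≡-Reasoning

sumℕ≡sum : ∀ k (f : Fin k → ℕ) → sumℕ k f ≡ Sum.sum +-0-monoid f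
sumℕ≡sum zero    f = ≡.refl
sumℕ≡sum (suc k) f = ≡.cong (f zero +_) (sumℕ≡sum k (f ∘ suc))

×≡* : ∀ m k → Mult._×_ +-0-monoid m k ≡ m * k
×≡* zero    k = ≡.refl
×≡* (suc m) k = ≡.cong (k +_) (×≡* m k)

1<prime : ∀ {p} → Prime p → 1 < p
1<prime {p} p-prime = nonTrivial⇒n>1 p {{prime⇒nonTrivial p-prime}}

prime-factor : ∀ m → 2 ≤ m → ∃ λ p → Prime p × p ∣ m
prime-factor m@(suc _) 2≤m with factorise m
... | record { factors = List.[] ; isFactorisation = m≡1 } = contradiction m≡1 (>⇒≢ 2≤m)
... | record { factors = p List.∷ ps ; isFactorisation = m≡p*ps ; factorsPrime = p-prime All.∷ _ } =
  p , p-prime , divides (product ps) (≡.trans m≡p*ps (*-comm p (product ps)))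

prime∤⇒coprime : ∀ {p a} → Prime p → ¬ p ∣ a → Coprime p a
prime∤⇒coprime p-prime p∤a (i∣p , i∣a) with prime⇒irreducible p-prime i∣p
... | inj₁ i≡1 = i≡1
... | inj₂ ≡.refl = contradiction i∣a p∤a

coprime-*ʳ : ∀ {a b c} → Coprime a b → Coprime a c → Coprime a (b * c)
coprime-*ʳ coprime-ab coprime-ac (i∣a , i∣bc) =
  coprime-ac (i∣a , coprime-divisor (λ (j∣i , j∣b) → coprime-ab (∣-trans j∣i i∣a , j∣b)) i∣bc)

coprime⇒*∣ : ∀ {u w m} → Coprime u w → u ∣ m → w ∣ m → u * w ∣ m
coprime⇒*∣ {u} {w} coprime u∣m w∣m = ≡.subst (_∣ _) lcm≡u*w (lcm-least u∣m w∣m)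
  where
  lcm≡u*w : lcm u w ≡ u * w
  lcm≡u*w = ≡.trans (≡.sym (*-identityˡ (lcm u w)))
              (≡.trans (≡.cong (_* lcm u w) (≡.sym (coprime⇒gcd≡1 coprime))) (gcd*lcm u w))

CoprimeSplit : ℕ → ℕ → Set
CoprimeSplit d m = ∃₂ λ u w → u ∣ d × w ∣ m × Coprime u w × d < u * w

coprimeSplit-* : ∀ {d m p} → Prime p → CoprimeSplit d m → CoprimeSplit (d * p) (m * p)
coprimeSplit-* {p = p} p-prime (u , w , u∣d , w∣m , coprime , d<uw) with p ∣? w
... | yes p∣w = u , w * p , ∣-trans u∣d (m∣m*n p) , *-monoˡ-∣ p w∣m ,
      coprime-*ʳ coprime (Coprime.sym (prime∤⇒coprime p-prime p∤u)) ,
      ≤-trans (*-monoˡ-< p d<uw) (≤-reflexive (*-assoc u w p))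
  where
  instance _ = prime⇒nonZero p-prime
  p∤u : ¬ p ∣ u
  p∤u p∣u = contradiction (coprime (p∣u , p∣w)) (>⇒≢ (1<prime p-prime))
... | no p∤w = u * p , w , *-monoˡ-∣ p u∣d , ∣-trans w∣m (m∣m*n p) ,
      Coprime.sym (coprime-*ʳ (Coprime.sym coprime) (Coprime.sym (prime∤⇒coprime p-prime p∤w))) ,
      ≤-trans (*-monoˡ-< p d<uw) (≤-reflexive (xy∙z≈xz∙y u w p))
  where instance _ = prime⇒nonZero p-prime

-- Induction on m: divide d and m by a common prime factor until they are coprime.
coprime-split : ∀ {d m} → 0 < d → 0 < m → ¬ m ∣ d → CoprimeSplit d m
coprime-split {m = m} = <-rec (λ m → ∀ {d} → 0 < d → 0 < m → ¬ m ∣ d → CoprimeSplit d m) split m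
  where
  split : ∀ m → (∀ {m′} → m′ < m → ∀ {d} → 0 < d → 0 < m′ → ¬ m′ ∣ d → CoprimeSplit d m′) →
          ∀ {d} → 0 < d → 0 < m → ¬ m ∣ d → CoprimeSplit d m
  split m smaller {d} 0<d 0<m m∤d with coprime? d m
  ... | yes coprime = d , m , ∣-refl , ∣-refl , coprime , m<m*n d m {{>-nonZero 0<d}} 1<m
    where
    1<m : 1 < m
    1<m = ≤∧≢⇒< 0<m λ 1≡m → m∤d (≡.subst (_∣ d) 1≡m (1∣ d))
  ... | no ¬coprime with prime-factor (gcd d m) 2≤gcd
    where
    2≤gcd : 2 ≤ gcd d m
    2≤gcd = ≤∧≢⇒< (n≢0⇒n>0 (gcd[m,n]≢0 d m (inj₁ (>⇒≢ 0<d))))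
                  (λ 1≡gcd → ¬coprime (gcd≡1⇒coprime (≡.sym 1≡gcd)))
  ... | p , p-prime , p∣gcd
    with divides d′ ≡.refl ← ∣-trans p∣gcd (gcd[m,n]∣m d m)
       | divides m′ ≡.refl ← ∣-trans p∣gcd (gcd[m,n]∣n d m) =
    coprimeSplit-* p-prime (smaller m′<m (positive d′ 0<d) (positive m′ 0<m) (m∤d ∘ *-monoˡ-∣ p))
    where
    instance _ = prime⇒nonZero p-prime
    positive : ∀ k → 0 < k * p → 0 < k
    positive (suc _) _ = z<s
    m′<m : m′ < m′ * p
    m′<m = m<m*n m′ p {{>-nonZero (positive m′ 0<m)}} (1<prime p-prime)

greedy : ∀ {a p} {A : Set a} (P : ∀ {k} → (Fin k → A) → Set p) → ∀ K → P [] →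
         (∀ {k} (U : Fin k → A) → k < K → P U → ∃ λ y → P (y ∷ U)) → Σ (Fin K → A) P
greedy P zero    P[] step = [] , P[]
greedy P (suc K) P[] step with greedy P K P[] (λ U k<K → step U (m<n⇒m<1+n k<K))
... | U , PU with step U ≤-refl PU
... | y , Py∷U = y ∷ U , Py∷U

module FiniteSetoid {c ℓ} (S : Setoid c ℓ) where
  open Setoid S

  infix 4 _∉_
  _∉_ : ∀ {M} → Carrier → (Fin M → Carrier) → Set ℓ
  z ∉ f = ∀ i → ¬ f i ≈ z

  ∷-injective : ∀ {M z} {f : Fin M → Carrier} → z ∉ f → Injective _≡_ _≈_ f → Injective _≡_ _≈_ (z ∷ f)
  ∷-injective z∉f f-inj {zero}  {zero}  _     = ≡.refl
  ∷-injective z∉f f-inj {zero}  {suc j} z≈fj  = contradiction (sym z≈fj) (z∉f j)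
  ∷-injective z∉f f-inj {suc i} {zero}  fi≈z  = contradiction fi≈z (z∉f i)
  ∷-injective z∉f f-inj {suc i} {suc j} fi≈fj = ≡.cong suc (f-inj fi≈fj)

  ++-injective : ∀ {M L} {f : Fin M → Carrier} {g : Fin L → Carrier} →
                 Injective _≡_ _≈_ f → Injective _≡_ _≈_ g → (∀ i j → ¬ f i ≈ g j) →
                 Injective _≡_ _≈_ (f ++ g)
  ++-injective {M} {L} {f} {g} f-inj g-inj f≉g {i} {j} eq =
    ≡.trans (≡.sym (Fin.join-splitAt M L i))
      (≡.trans (≡.cong (Data.Fin.join M L) (split (splitAt M i) (splitAt M j) eq)) (Fin.join-splitAt M L j))
    where
    split : ∀ s t → [ f , g ] s ≈ [ f , g ] t → s ≡ t
    split (inj₁ i) (inj₁ j) eq = ≡.cong inj₁ (f-inj eq)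
    split (inj₁ i) (inj₂ j) eq = contradiction eq (f≉g i j)
    split (inj₂ i) (inj₁ j) eq = contradiction (sym eq) (f≉g j i)
    split (inj₂ i) (inj₂ j) eq = ≡.cong inj₂ (g-inj eq)

  ∉-++⁻ : ∀ {M L z} (f : Fin M → Carrier) (g : Fin L → Carrier) → z ∉ f ++ g → z ∉ f × z ∉ g
  ∉-++⁻ {M} {L} f g z∉f++g =
    (λ i → ≡.subst (λ s → ¬ [ f , g ] s ≈ _) (Fin.splitAt-↑ˡ M i L) (z∉f++g (i ↑ˡ L))) ,
    (λ j → ≡.subst (λ s → ¬ [ f , g ] s ≈ _) (Fin.splitAt-↑ʳ M L j) (z∉f++g (M ↑ʳ j)))

  ∉-++⁺ : ∀ {M L z} {f : Fin M → Carrier} {g : Fin L → Carrier} → z ∉ f → z ∉ g → z ∉ f ++ g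
  ∉-++⁺ {M} {z = z} {f} {g} z∉f z∉g i = [_,_] {C = λ s → ¬ [ f , g ] s ≈ z} z∉f z∉g (splitAt M i)

  ∈-or-∉ : Decidable _≈_ → ∀ {M} (f : Fin M → Carrier) z → (∃ λ i → f i ≈ z) Data.Sum.⊎ z ∉ f
  ∈-or-∉ _≟_ f z with Fin.any? (λ i → f i ≟ z)
  ... | yes z∈f = inj₁ z∈f
  ... | no z∉f = inj₂ λ i fi≈z → z∉f (i , fi≈z)

  reindex : ∀ {A : Set} {M} {f : A → Carrier} (π : Fin M ↔ A) →
            Injective _≡_ _≈_ f → Injective _≡_ _≈_ (f ∘ Inverse.to π)
  reindex π f-inj fπi≈fπj = ≡.trans (≡.sym (Inverse.strictlyInverseʳ π _))
    (≡.trans (≡.cong (Inverse.from π) (f-inj fπi≈fπj)) (Inverse.strictlyInverseʳ π _))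

  Enumeration : ℕ → Set (c ⊔ ℓ)
  Enumeration N = Σ (Fin N → Carrier) λ e → Injective _≡_ _≈_ e × StrictlySurjective _≈_ e

  enumerate : ∀ {N} → Decidable _≈_ →
              (∀ {M} (f : Fin M → Carrier) → Injective _≡_ _≈_ f → M ≤ N) →
              (∀ {M} (f : Fin M → Carrier) → M < N → ∃ λ z → z ∉ f) → Enumeration N
  enumerate {N} _≟_ bound missing = e , e-injective , e-surjective
    where
    enum = greedy (Injective _≡_ _≈_) N (λ { {()} })
             λ U k<N U-inj → let z , z∉U = missing U k<N in z , ∷-injective z∉U U-inj
    e = proj₁ enum
    e-injective = proj₂ enum
    e-surjective : StrictlySurjective _≈_ e
    e-surjective z with ∈-or-∉ _≟_ e z
    ... | inj₁ z∈e = z∈e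
    ... | inj₂ z∉e = contradiction (bound (z ∷ e) (∷-injective z∉e e-injective)) 1+n≰n

  module Enumerated {N} (enumeration : Enumeration N) where
    private
      e = proj₁ enumeration
      e-injective = proj₁ (proj₂ enumeration)
      index : Carrier → Fin N
      index x = proj₁ (proj₂ (proj₂ enumeration) x)
      e-index : ∀ x → e (index x) ≈ x
      e-index x = proj₂ (proj₂ (proj₂ enumeration) x)

    _≟_ : Decidable _≈_
    x ≟ y = Dec.map′ (λ i≡j → trans (sym (e-index x)) (trans (reflexive (≡.cong e i≡j)) (e-index y)))
                     (λ x≈y → e-injective (trans (e-index x) (trans x≈y (sym (e-index y)))))
                     (index x Fin.≟ index y)

    any? : ∀ {p} {P : Pred Carrier p} → (∀ {x y} → x ≈ y → P x → P y) → Decidable₁ P → Dec.Dec (∃ P)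
    any? resp P? = Dec.map′ (λ (i , Pei) → e i , Pei) (λ (x , Px) → index x , resp (sym (e-index x)) Px)
                            (Fin.any? (P? ∘ e))

    ¬∀⇒∃¬ : ∀ {p} {P : Pred Carrier p} → (∀ {x y} → x ≈ y → P x → P y) → Decidable₁ P →
            ¬ (∀ x → P x) → ∃ λ x → ¬ P x
    ¬∀⇒∃¬ {P = P} resp P? ¬∀P =
      let i , ¬Pei = Fin.¬∀⟶∃¬ N (P ∘ e) (P? ∘ e) (λ ∀P → ¬∀P λ x → resp (e-index x) (∀P (index x)))
      in e i , ¬Pei

    injective⇒≤ : ∀ {M} {f : Fin M → Carrier} → Injective _≡_ _≈_ f → M ≤ N
    injective⇒≤ {f = f} f-inj = Fin.injective⇒≤ λ {i} {j} index≡ →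
      f-inj (trans (sym (e-index (f i))) (trans (reflexive (≡.cong e index≡)) (e-index (f j))))

    missing : ∀ {M} (f : Fin M → Carrier) → M < N → ∃ λ z → z ∉ f
    missing {M} f M<N with ¬∀⇒∃¬ (λ x≈y (i , fi≈x) → i , trans fi≈x x≈y) (λ z → Fin.any? (λ i → f i ≟ z)) ¬onto
      where
      ¬onto : ¬ StrictlySurjective _≈_ f
      ¬onto hit = <⇒≱ M<N (Fin.injective⇒≤ {f = proj₁ ∘ hit ∘ e} λ {k} {l} h≡ → e-injective
        (trans (sym (proj₂ (hit (e k)))) (trans (reflexive (≡.cong f h≡)) (proj₂ (hit (e l))))))
    ... | z , z∉f = z , λ i fi≈z → z∉f (i , fi≈z)

    injective⇒surjective : ∀ {M} {f : Fin M → Carrier} → N ≤ M → Injective _≡_ _≈_ f → StrictlySurjective _≈_ f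
    injective⇒surjective {f = f} N≤M f-inj z with ∈-or-∉ _≟_ f z
    ... | inj₁ z∈f = z∈f
    ... | inj₂ z∉f = contradiction (≤-trans (injective⇒≤ (∷-injective z∉f f-inj)) N≤M) 1+n≰n

    -- A section of f is injective, hence onto by counting.
    surjective⇒injective : ∀ {f : Carrier → Carrier} → Congruent _≈_ _≈_ f → StrictlySurjective _≈_ f →
                           Injective _≈_ _≈_ f
    surjective⇒injective {f} f-cong f-surj {x} {y} fx≈fy =
      let k , sk≈x = section-onto x
          l , sl≈y = section-onto y
          k≡l = e-injective (trans (sym (f-section k))
                  (trans (f-cong sk≈x) (trans fx≈fy (trans (f-cong (sym sl≈y)) (f-section l)))))
      in trans (sym sk≈x) (trans (reflexive (≡.cong section k≡l)) sl≈y)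
      where
      section : Fin N → Carrier
      section k = proj₁ (f-surj (e k))
      f-section : ∀ k → f (section k) ≈ e k
      f-section k = proj₂ (f-surj (e k))
      section-onto = injective⇒surjective ≤-refl λ {k} {l} sk≈sl →
        e-injective (trans (sym (f-section k)) (trans (f-cong sk≈sl) (f-section l)))

module Iterated {a ℓ} (G : AbelianGroup a ℓ) where
  open AbelianGroup G
  import Algebra.Properties.CommutativeMonoid.Mult commutativeMonoid as CM
  open import Relation.Binary.Reasoning.Setoid setoid

  infixr 8 _·_
  _·_ : ℕ → Carrier → Carrier
  _·_ = _•_ G

  ·≡× : ∀ m x → m · x ≡ m CM.× x
  ·≡× zero    x = ≡.refl
  ·≡× (suc m) x = ≡.cong (x ∙_) (·≡× m x)

  ·-homo-+ : ∀ x m k → (m + k) · x ≈ m · x ∙ k · x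
  ·-homo-+ x m k rewrite ·≡× (m + k) x | ·≡× m x | ·≡× k x = CM.×-homo-+ x m k

  ·-assocˡ : ∀ x m k → m · k · x ≈ (m * k) · x
  ·-assocˡ x m k rewrite ·≡× k x | ·≡× m (k CM.× x) | ·≡× (m * k) x = CM.×-assocˡ x m k

  ·-congʳ : ∀ m {x y} → x ≈ y → m · x ≈ m · y
  ·-congʳ m {x} {y} x≈y rewrite ·≡× m x | ·≡× m y = CM.×-congʳ m x≈y

  ·-distrib-∙ : ∀ x y m → m · (x ∙ y) ≈ m · x ∙ m · y
  ·-distrib-∙ x y m rewrite ·≡× m (x ∙ y) | ·≡× m x | ·≡× m y = CM.×-distrib-+ x y m

  annihilator-*ˡ : ∀ {d x} → d · x ≈ ε → ∀ q → (q * d) · x ≈ ε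
  annihilator-*ˡ d·x≈ε zero    = refl
  annihilator-*ˡ {d} {x} d·x≈ε (suc q) = begin
    (d + q * d) · x    ≈⟨ ·-homo-+ x d (q * d) ⟩
    d · x ∙ (q * d) · x ≈⟨ ∙-cong d·x≈ε (annihilator-*ˡ d·x≈ε q) ⟩
    ε ∙ ε              ≈⟨ identityˡ ε ⟩
    ε                  ∎

  annihilator-*ʳ : ∀ {d x} → d · x ≈ ε → ∀ q → (d * q) · x ≈ ε
  annihilator-*ʳ {d} {x} d·x≈ε q = trans (reflexive (≡.cong (_· x) (*-comm d q))) (annihilator-*ˡ d·x≈ε q)

  ∑≡sum : ∀ k (f : Fin k → Carrier) → ∑ G k f ≡ Sum.sum monoid f
  ∑≡sum zero    f = ≡.refl
  ∑≡sum (suc k) f = ≡.cong (f zero ∙_) (∑≡sum k (f ∘ suc))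

module ElementOrders {a ℓ} (G : AbelianGroup a ℓ) where
  open AbelianGroup G
  open Iterated G
  open import Relation.Binary.Reasoning.Setoid setoid

  Order : Carrier → ℕ → Set ℓ
  Order = ElementOrder G

  order-intro : ∀ {x d} → 0 < d → d · x ≈ ε → (∀ m → 0 < m → m · x ≈ ε → d ∣ m) → Order x d
  order-intro 0<d d·x≈ε d∣ = 0<d , d·x≈ε , λ m 0<m m·x≈ε → ∣⇒≤ {{>-nonZero 0<m}} (d∣ m 0<m m·x≈ε)

  order-∣ : ∀ {x d m} → Order x d → m · x ≈ ε → d ∣ m
  order-∣ {x} {d} {m} (0<d , d·x≈ε , minimal) m·x≈ε = m%n≡0⇒n∣m m d remainder≡0
    where
    instance _ = >-nonZero 0<d
    remainder·x≈ε : (m % d) · x ≈ ε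
    remainder·x≈ε = begin
      (m % d) · x                  ≈⟨ identityʳ _ ⟨
      (m % d) · x ∙ ε              ≈⟨ ∙-congˡ (annihilator-*ˡ d·x≈ε (m / d)) ⟨
      (m % d) · x ∙ (m / d * d) · x ≈⟨ ·-homo-+ x (m % d) (m / d * d) ⟨
      (m % d + m / d * d) · x      ≡⟨ ≡.cong (_· x) (m≡m%n+[m/n]*n m d) ⟨
      m · x                        ≈⟨ m·x≈ε ⟩
      ε                            ∎
    remainder≡0 : m % d ≡ 0
    remainder≡0 with m % d | remainder·x≈ε | m%n<n m d
    ... | zero  | _ | _ = ≡.refl
    ... | suc r | r·x≈ε | r<d = contradiction (minimal (suc r) z<s r·x≈ε) (<⇒≱ r<d)

  order-unique : ∀ {x d d′} → Order x d → Order x d′ → d ≡ d′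
  order-unique (0<d , d·x≈ε , d-min) (0<d′ , d′·x≈ε , d′-min) = ≤-antisym (d-min _ 0<d′ d′·x≈ε) (d′-min _ 0<d d·x≈ε)

  order-resp : ∀ {x y d} → x ≈ y → Order x d → Order y d
  order-resp {d = d} x≈y (0<d , d·x≈ε , minimal) =
    0<d , trans (·-congʳ d (sym x≈y)) d·x≈ε , λ m 0<m m·y≈ε → minimal m 0<m (trans (·-congʳ m x≈y) m·y≈ε)

  order-· : ∀ {x} t u → Order x (t * u) → Order (t · x) u
  order-· {x} t u ox@(0<tu , tu·x≈ε , _) = order-intro 0<u u·t·x≈ε u∣
    where
    instance
      _ = >-nonZero 0<tu
      _ = m*n≢0⇒m≢0 t
    0<u : 0 < u
    0<u = >-nonZero⁻¹ u {{m*n≢0⇒n≢0 t}}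
    u·t·x≈ε : u · t · x ≈ ε
    u·t·x≈ε = trans (·-assocˡ x u t) (trans (reflexive (≡.cong (_· x) (*-comm u t))) tu·x≈ε)
    u∣ : ∀ m → 0 < m → m · t · x ≈ ε → u ∣ m
    u∣ m _ m·t·x≈ε =
      *-cancelˡ-∣ t (≡.subst (t * u ∣_) (*-comm m t) (order-∣ ox (trans (sym (·-assocˡ x m t)) m·t·x≈ε)))

  order-∙ : ∀ {x y u w} → Order x u → Order y w → Coprime u w → Order (x ∙ y) (u * w)
  order-∙ {x} {y} {u} {w} ox@(0<u , u·x≈ε , _) oy@(0<w , w·y≈ε , _) coprime =
    order-intro (>-nonZero⁻¹ (u * w) {{m*n≢0 u w {{>-nonZero 0<u}} {{>-nonZero 0<w}}}}) uw·xy≈ε uw∣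
    where
    component : ∀ {k x y} → k · (x ∙ y) ≈ ε → k · y ≈ ε → k · x ≈ ε
    component {k} {x} {y} k·xy≈ε k·y≈ε = begin
      k · x         ≈⟨ identityʳ _ ⟨
      k · x ∙ ε     ≈⟨ ∙-congˡ k·y≈ε ⟨
      k · x ∙ k · y ≈⟨ ·-distrib-∙ x y k ⟨
      k · (x ∙ y)   ≈⟨ k·xy≈ε ⟩
      ε             ∎
    uw·xy≈ε : (u * w) · (x ∙ y) ≈ ε
    uw·xy≈ε = begin
      (u * w) · (x ∙ y)         ≈⟨ ·-distrib-∙ x y (u * w) ⟩
      (u * w) · x ∙ (u * w) · y ≈⟨ ∙-cong (annihilator-*ʳ {u} {x} u·x≈ε w) (annihilator-*ˡ {w} {y} w·y≈ε u) ⟩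
      ε ∙ ε                     ≈⟨ identityˡ ε ⟩
      ε                         ∎
    uw∣ : ∀ m → 0 < m → m · (x ∙ y) ≈ ε → u * w ∣ m
    uw∣ m _ m·xy≈ε = coprime⇒*∣ coprime
      (coprime-divisor coprime (order-∣ ox (component {w * m} {x} {y}
        (annihilator-*ˡ {m} {x ∙ y} m·xy≈ε w) (annihilator-*ʳ {w} {y} w·y≈ε m))))
      (coprime-divisor (Coprime.sym coprime) (order-∣ oy (component {u * m} {y} {x}
        (annihilator-*ˡ {m} {y ∙ x} (trans (·-congʳ m (comm y x)) m·xy≈ε) u) (annihilator-*ʳ {u} {x} u·x≈ε m))))

  order-exists : Decidable _≈_ → ∀ {x e} → 0 < e → e · x ≈ ε → ∃ (Order x)
  order-exists _≟_ {x} 0<e e·x≈ε =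
    let d , (0<d , d·x≈ε) , least-d = least (λ m → (0 <? m) ×-dec ((m · x) ≟ ε)) (0<e , e·x≈ε)
    in d , 0<d , d·x≈ε , λ m 0<m m·x≈ε → least-d (0<m , m·x≈ε)

  -- If the order m of y did not divide d, coprime parts of d and m would give an element of order greater than d.
  maximal-order-annihilates : ∀ {x d} → Order x d → (∀ {z o} → Order z o → o ≤ d) → ∀ {y m} → Order y m → d · y ≈ ε
  maximal-order-annihilates {x} {d} ox maximal {y} {m} oy with m ∣? d
  ... | yes (divides q d≡qm) = trans (reflexive (≡.cong (_· y) d≡qm)) (annihilator-*ˡ {m} {y} (proj₁ (proj₂ oy)) q)
  ... | no m∤d with coprime-split (proj₁ ox) (proj₁ oy) m∤d
  ... | u , w , divides q₁ d≡q₁u , divides q₂ m≡q₂w , coprime , d<uw =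
    contradiction (maximal (order-∙ (order-· q₁ u (≡.subst (Order x) d≡q₁u ox))
                                    (order-· q₂ w (≡.subst (Order y) m≡q₂w oy)) coprime)) (<⇒≱ d<uw)

module Exponent {a ℓ} (G : AbelianGroup a ℓ) {N} (enumeration : FiniteSetoid.Enumeration (AbelianGroup.setoid G) N)
                {e} (exponent : IsExponent G e) where
  open AbelianGroup G
  open Iterated G
  open ElementOrders G
  open FiniteSetoid.Enumerated setoid enumeration using (_≟_)
  open import Data.List.Extrema ≤-totalOrder using (argmax; f[xs]≤f[argmax])

  private
    0<e = proj₁ exponent
    order : ∀ x → ∃ (Order x)
    order x = order-exists _≟_ 0<e (proj₁ (proj₂ exponent) x)
    enum = proj₁ enumeration
    index : Carrier → Fin N
    index x = proj₁ (proj₂ (proj₂ enumeration) x)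
    enum-index : ∀ x → enum (index x) ≈ x
    enum-index x = proj₂ (proj₂ (proj₂ enumeration) x)
    ord : Fin N → ℕ
    ord = proj₁ ∘ order ∘ enum
    max = enum (argmax ord (index ε) (List.allFin N))
    d = proj₁ (order max)
    order-max = proj₂ (order max)

  order-≤-max : ∀ {y o} → Order y o → o ≤ d
  order-≤-max {y} oy =
    ≡.subst (_≤ d) (order-unique (proj₂ (order (enum (index y)))) (order-resp (sym (enum-index y)) oy))
      (All.lookup (f[xs]≤f[argmax] {f = ord} (index ε) (List.allFin N)) (∈-allFin (index y)))

  max-annihilates : ∀ y → d · y ≈ ε
  max-annihilates y = maximal-order-annihilates order-max order-≤-max (proj₂ (order y))

  order-max≡exponent : d ≡ e
  order-max≡exponent = ≤-antisym (proj₂ (proj₂ order-max) e 0<e (proj₁ (proj₂ exponent) max))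
                                 (proj₂ (proj₂ exponent) d (proj₁ order-max) max-annihilates)

  ∃-order : ∀ {n} → n ∣ e → ∃ λ g → Order g n
  ∃-order {n} (divides q e≡qn) =
    q · max , order-· q n (≡.subst (Order max) (≡.trans order-max≡exponent e≡qn) order-max)

module Quotient {a ℓ p} (G : AbelianGroup a ℓ) (H : Pred (AbelianGroup.Carrier G) p)
                (H-resp : ∀ {x y} → AbelianGroup._≈_ G x y → H x → H y)
                (H-ε : H (AbelianGroup.ε G))
                (H-∙ : ∀ {x y} → H x → H y → H (AbelianGroup._∙_ G x y))
                (H-⁻¹ : ∀ {x} → H x → H (AbelianGroup._⁻¹ G x)) where
  open AbelianGroup G
  open import Algebra.Properties.AbelianGroup G
  open import Algebra.Properties.CommutativeSemigroup commutativeSemigroup using (interchange)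
  open import Relation.Binary.Reasoning.Setoid setoid

  infix 4 _~_
  _~_ : Carrier → Carrier → Set p
  x ~ y = H (x - y)

  ≈⇒~ : ∀ {x y} → x ≈ y → x ~ y
  ≈⇒~ {x} {y} x≈y = H-resp (trans (sym (inverseʳ y)) (∙-congʳ (sym x≈y))) H-ε

  ~-sym : ∀ {x y} → x ~ y → y ~ x
  ~-sym {x} {y} = H-resp (⁻¹-anti-homo‿- x y) ∘ H-⁻¹

  ~-trans : ∀ {x y z} → x ~ y → y ~ z → x ~ z
  ~-trans {x} {y} {z} x~y y~z = H-resp x-y∙y-z≈x-z (H-∙ x~y y~z)
    where
    x-y∙y-z≈x-z : (x - y) ∙ (y - z) ≈ x - z
    x-y∙y-z≈x-z = begin
      (x - y) ∙ (y ∙ z ⁻¹) ≈⟨ assoc (x - y) y (z ⁻¹) ⟨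
      (x - y) ∙ y ∙ z ⁻¹   ≈⟨ ∙-congʳ (//-rightDividesˡ y x) ⟩
      x ∙ z ⁻¹             ∎

  ∙-cong~ : ∀ {x y u v} → x ~ y → u ~ v → x ∙ u ~ y ∙ v
  ∙-cong~ {x} {y} {u} {v} x~y u~v = H-resp (begin
      (x - y) ∙ (u - v)        ≈⟨ interchange x (y ⁻¹) u (v ⁻¹) ⟩
      (x ∙ u) ∙ (y ⁻¹ ∙ v ⁻¹)  ≈⟨ ∙-congˡ (⁻¹-∙-comm y v) ⟩
      (x ∙ u) - (y ∙ v)        ∎) (H-∙ x~y u~v)

  ⁻¹-cong~ : ∀ {x y} → x ~ y → x ⁻¹ ~ y ⁻¹
  ⁻¹-cong~ {x} {y} x~y = H-resp (begin
      y - x        ≈⟨ comm y (x ⁻¹) ⟩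
      x ⁻¹ ∙ y     ≈⟨ ∙-congˡ (⁻¹-involutive y) ⟨
      x ⁻¹ - y ⁻¹  ∎) (~-sym x~y)

  quotient : AbelianGroup a p
  quotient = record
    { Carrier = Carrier ; _≈_ = _~_ ; _∙_ = _∙_ ; ε = ε ; _⁻¹ = _⁻¹
    ; isAbelianGroup = record
      { isGroup = record
        { isMonoid = record
          { isSemigroup = record
            { isMagma = record
              { isEquivalence = record { refl = ≈⇒~ refl ; sym = ~-sym ; trans = ~-trans }
              ; ∙-cong = ∙-cong~ }
            ; assoc = λ x y z → ≈⇒~ (assoc x y z) }
          ; identity = (λ x → ≈⇒~ (identityˡ x)) , (λ x → ≈⇒~ (identityʳ x)) }
        ; inverse = (λ x → ≈⇒~ (inverseˡ x)) , (λ x → ≈⇒~ (inverseʳ x))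
        ; ⁻¹-cong = ⁻¹-cong~ }
      ; comm = λ x y → ≈⇒~ (comm x y) } }

  x∙h~x : ∀ x {h} → H h → x ∙ h ~ x
  x∙h~x x {h} h∈H = H-resp (sym (xyx⁻¹≈y x h)) h∈H

module Cyclic {a ℓ} (G : AbelianGroup a ℓ) {g n} (g-order : ElementOrder G g n) where
  open AbelianGroup G
  open import Algebra.Properties.AbelianGroup G
  open Iterated G
  open import Relation.Binary.Reasoning.Setoid setoid

  private instance
    n-nonZero : NonZero n
    n-nonZero = >-nonZero (proj₁ g-order)

  ⟨g⟩ : Pred Carrier ℓ
  ⟨g⟩ z = ∃ λ k → z ≈ k · g

  ·-+-multiple : ∀ k q → (k + q * n) · g ≈ k · g
  ·-+-multiple k q = begin
    (k + q * n) · g      ≈⟨ ·-homo-+ g k (q * n) ⟩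
    k · g ∙ (q * n) · g  ≈⟨ ∙-congˡ (annihilator-*ˡ {n} {g} (proj₁ (proj₂ g-order)) q) ⟩
    k · g ∙ ε            ≈⟨ identityʳ _ ⟩
    k · g                ∎

  ·-≡-mod : ∀ {k q l q′} → k + q * n ≡ l + q′ * n → k · g ≈ l · g
  ·-≡-mod {k} {q} {l} {q′} k+qn≡l+q′n =
    trans (sym (·-+-multiple k q)) (trans (reflexive (≡.cong (_· g) k+qn≡l+q′n)) (·-+-multiple l q′))

  ·-% : ∀ k → k · g ≈ (k % n) · g
  ·-% k = ·-≡-mod {k} {0} {k % n} {k / n} (≡.trans (+-identityʳ k) (m≡m%n+[m/n]*n k n))

  ⟨g⟩-reduce : ∀ {z} → ⟨g⟩ z → ∃ λ (i : Fin n) → z ≈ toℕ i · g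
  ⟨g⟩-reduce {z} (k , z≈k·g) = fromℕ< (m%n<n k n) ,
    trans z≈k·g (trans (·-% k) (reflexive (≡.cong (_· g) (≡.sym (Fin.toℕ-fromℕ< (m%n<n k n))))))

  private
    offset-zero : ∀ {i j} → i ≤ j → j < n → i · g ≈ j · g → j ≡ i
    offset-zero {i} i≤j j<n i·g≈j·g with m≤n⇒∃[o]m+o≡n i≤j
    ... | zero , ≡.refl = +-identityʳ i
    ... | suc d , ≡.refl = contradiction (proj₂ (proj₂ g-order) (suc d) z<s d·g≈ε) (<⇒≱ (≤-<-trans (m≤n+m _ i) j<n))
      where d·g≈ε = identityʳ-unique (i · g) (suc d · g) (sym (trans i·g≈j·g (·-homo-+ g i (suc d))))

  ·-injective : ∀ {i j} → i < n → j < n → i · g ≈ j · g → i ≡ j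
  ·-injective {i} {j} i<n j<n i·g≈j·g with ≤-total i j
  ... | inj₁ i≤j = ≡.sym (offset-zero i≤j j<n i·g≈j·g)
  ... | inj₂ j≤i = offset-zero j≤i i<n (sym i·g≈j·g)

  ⟨g⟩-⁻¹ : ∀ {z} → ⟨g⟩ z → ⟨g⟩ (z ⁻¹)
  ⟨g⟩-⁻¹ {z} (k , z≈k·g) = pred n * k , (begin
    z ⁻¹               ≈⟨ ⁻¹-cong z≈k·g ⟩
    (k · g) ⁻¹         ≈⟨ inverseʳ-unique (k · g) _ k·g∙pk·g≈ε ⟨
    (pred n * k) · g   ∎)
    where
    k·g∙pk·g≈ε : k · g ∙ (pred n * k) · g ≈ ε
    k·g∙pk·g≈ε = begin
      k · g ∙ (pred n * k) · g ≈⟨ ·-homo-+ g k (pred n * k) ⟨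
      (suc (pred n) * k) · g   ≡⟨ ≡.cong (λ m → (m * k) · g) (suc-pred n) ⟩
      (n * k) · g              ≈⟨ annihilator-*ʳ {n} {g} (proj₁ (proj₂ g-order)) k ⟩
      ε                        ∎

  open Quotient G ⟨g⟩ (λ x≈y (k , x≈k·g) → k , trans (sym x≈y) x≈k·g) (0 , refl)
    (λ (k , x≈k·g) (l , y≈l·g) → k + l , trans (∙-cong x≈k·g y≈l·g) (sym (·-homo-+ g k l))) ⟨g⟩-⁻¹ public

  ~-decidable : Decidable _≈_ → Decidable _~_
  ~-decidable _≟_ x y = Dec.map′ (λ (i , p) → toℕ i , p) ⟨g⟩-reduce (Fin.any? λ i → (x - y) ≟ (toℕ i · g))

  -- The cosets of ⟨g⟩ have n elements each, so a group of order r * n has r cosets.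
  quotient-enumeration : ∀ {N r} → FiniteSetoid.Enumeration setoid N → N ≡ r * n →
                         FiniteSetoid.Enumeration (AbelianGroup.setoid quotient) r
  quotient-enumeration {N} {r} enumeration N≡r*n =
    enumerate (~-decidable _≟_) quotient-bound quotient-missing
    where
    open FiniteSetoid setoid using (reindex)
    open FiniteSetoid.Enumerated setoid enumeration using (_≟_; injective⇒≤; missing)
    open FiniteSetoid (AbelianGroup.setoid quotient) using (enumerate)

    translates : ∀ {M} → (Fin M → Carrier) → Fin M × Fin n → Carrier
    translates f (k , i) = f k ∙ toℕ i · g

    translates-injective : ∀ {M} {f : Fin M → Carrier} → Injective _≡_ _~_ f → Injective _≡_ _≈_ (translates f)
    translates-injective {f = f} f-inj {k , i} {l , j} fk∙i·g≈fl∙j·g with f-inj fk~fl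
      where
      fk~fl = ~-trans (~-sym (x∙h~x (f k) (toℕ i , refl)))
                      (~-trans (≈⇒~ fk∙i·g≈fl∙j·g) (x∙h~x (f l) (toℕ j , refl)))
    ... | ≡.refl = ≡.cong (k ,_) (Fin.toℕ-injective
      (·-injective (Fin.toℕ<n i) (Fin.toℕ<n j) (∙-cancelˡ (f k) _ _ fk∙i·g≈fl∙j·g)))

    quotient-bound : ∀ {M} (f : Fin M → Carrier) → Injective _≡_ _~_ f → M ≤ r
    quotient-bound {M} f f-inj =
      *-cancelʳ-≤ M r n (≡.subst (M * n ≤_) N≡r*n (injective⇒≤ (reindex Fin.*↔× (translates-injective f-inj))))

    quotient-missing : ∀ {M} (f : Fin M → Carrier) → M < r → ∃ λ z → ∀ k → ¬ f k ~ z
    quotient-missing {M} f M<r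
      with missing (translates f ∘ Inverse.to Fin.*↔×) (≡.subst (M * n <_) (≡.sym N≡r*n) (*-monoˡ-< n M<r))
    ... | z , z∉ = z , λ k fk~z → let i , z-fk≈i·g = ⟨g⟩-reduce (~-sym fk~z) in
      z∉ (combine k i) (begin
        translates f (remQuot n (combine k i)) ≡⟨ ≡.cong (translates f) (Fin.remQuot-combine k i) ⟩
        f k ∙ toℕ i · g                        ≈⟨ ∙-congˡ z-fk≈i·g ⟨
        f k ∙ (z - f k)                        ≈⟨ comm (f k) (z - f k) ⟩
        (z - f k) ∙ f k                        ≈⟨ //-rightDividesˡ (f k) z ⟩
        z                                      ∎)

module EvenOrder {a ℓ} (Q : AbelianGroup a ℓ) where
  open AbelianGroup Q
  open import Algebra.Properties.AbelianGroup Q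
  open FiniteSetoid setoid

  SumAvoiding : Carrier → ∀ {k} → (Fin k → Carrier) → Set ℓ
  SumAvoiding s U = Injective _≡_ _≈_ U × ∀ i j → ¬ U i ∙ U j ≈ s

  partners : Carrier → ∀ {k} → (Fin k → Carrier) → Fin (k + k) → Carrier
  partners s U = U ++ λ i → s - U i

  partners-injective : ∀ {s k} {U : Fin k → Carrier} → SumAvoiding s U → Injective _≡_ _≈_ (partners s U)
  partners-injective {s} {U = U} (U-injective , U∙U≉s) = ++-injective U-injective
    (λ s-Ui≈s-Uj → U-injective (⁻¹-injective (∙-cancelˡ s _ _ s-Ui≈s-Uj)))
    (λ i j Ui≈s-Uj → U∙U≉s i j (trans (∙-congʳ Ui≈s-Uj) (//-rightDividesˡ (U j) s)))

  sumAvoiding-[] : ∀ {s} → SumAvoiding s []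
  sumAvoiding-[] = (λ { {()} }) , λ ()

  sumAvoiding-∷ : ∀ {s k y} {U : Fin k → Carrier} → SumAvoiding s U → y ∉ partners s U → ¬ y ∙ y ≈ s →
                  SumAvoiding s (y ∷ U)
  sumAvoiding-∷ {s} {y = y} {U} (U-injective , U∙U≉s) y∉partners y∙y≉s =
    ∷-injective y∉U U-injective , y∷U∙y∷U≉s
    where
    y∉U = proj₁ (∉-++⁻ U _ y∉partners)
    y≉s-U = proj₂ (∉-++⁻ U _ y∉partners)
    y∷U∙y∷U≉s : ∀ i j → ¬ (y ∷ U) i ∙ (y ∷ U) j ≈ s
    y∷U∙y∷U≉s zero    zero    = y∙y≉s
    y∷U∙y∷U≉s zero    (suc j) y∙Uj≈s = y≉s-U j (sym (x≈z//y y (U j) s y∙Uj≈s))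
    y∷U∙y∷U≉s (suc i) zero    Ui∙y≈s = y≉s-U i (sym (x≈z//y y (U i) s (trans (comm y (U i)) Ui∙y≈s)))
    y∷U∙y∷U≉s (suc i) (suc j) = U∙U≉s i j

  module _ {K} (enumeration : Enumeration (K + K)) where
    open Enumerated enumeration

    -- Cauchy's theorem for the prime 2: without involutions, ε and K pairs {x , x ⁻¹} would be 2 K + 1 elements.
    ∃-involution : ∃ λ τ → ¬ τ ≈ ε × τ ∙ τ ≈ ε
    ∃-involution with any? (λ x≈y (x≉ε , x∙x≈ε) → x≉ε ∘ trans x≈y , trans (∙-cong (sym x≈y) (sym x≈y)) x∙x≈ε)
                           (λ τ → ¬? (τ ≟ ε) ×-dec ((τ ∙ τ) ≟ ε))
    ... | yes involution = involution
    ... | no no-involution = ⊥-elim (1+n≰n (injective⇒≤ (∷-injective ε∉partners (partners-injective avoiding))))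
      where
      step : ∀ {k} (U : Fin k → Carrier) → k < K → SumAvoiding ε U → ∃ λ y → SumAvoiding ε (y ∷ U)
      step {k} U k<K avoiding =
        let y , y∉ε∷partners = missing (ε ∷ partners ε U)
                                 (≤-trans (≤-reflexive (≡.cong suc (≡.sym (+-suc k k)))) (+-mono-≤ k<K k<K))
            y≉ε = λ y≈ε → y∉ε∷partners zero (sym y≈ε)
        in y , sumAvoiding-∷ avoiding (y∉ε∷partners ∘ suc) λ y∙y≈ε → no-involution (y , y≉ε , y∙y≈ε)
      U = proj₁ (greedy (SumAvoiding ε) K sumAvoiding-[] step)
      avoiding = proj₂ (greedy (SumAvoiding ε) K sumAvoiding-[] step)
      U≉ε : ∀ i → ¬ U i ≈ ε
      U≉ε i Ui≈ε = proj₂ avoiding i i (trans (∙-cong Ui≈ε Ui≈ε) (identityˡ ε))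
      ε∉partners : ε ∉ partners ε U
      ε∉partners = ∉-++⁺ U≉ε λ i → U≉ε i ∘ sym ∘ x∙y⁻¹≈ε⇒x≈y ε (U i)

    ∃-non-square : ∃ λ s → ∀ y → ¬ y ∙ y ≈ s
    ∃-non-square with ∃-involution
    ... | τ , τ≉ε , τ∙τ≈ε = s , λ y y∙y≈s → non-square (y , y∙y≈s)
      where
      squaring-not-onto : ¬ StrictlySurjective _≈_ (λ r → r ∙ r)
      squaring-not-onto squaring-surjective =
        τ≉ε (surjective⇒injective (λ x≈y → ∙-cong x≈y x≈y) squaring-surjective (trans τ∙τ≈ε (sym (identityˡ ε))))
      s,non-square = ¬∀⇒∃¬ (λ x≈y (r , r∙r≈x) → r , trans r∙r≈x x≈y)
        (λ s → any? (λ x≈y r∙r≈s → trans (∙-cong (sym x≈y) (sym x≈y)) r∙r≈s) (λ r → (r ∙ r) ≟ s))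
        squaring-not-onto
      s = proj₁ s,non-square
      non-square = proj₂ s,non-square

    ∃-sumAvoiding : ∃₂ λ s (U : Fin K → Carrier) → SumAvoiding s U
    ∃-sumAvoiding with ∃-non-square
    ... | s , non-square = s , greedy (SumAvoiding s) K sumAvoiding-[] λ {k} U k<K avoiding →
      let y , y∉partners = missing (partners s U) (+-mono-< k<K k<K)
      in y , sumAvoiding-∷ avoiding y∉partners (non-square y)

module Diagonals (n : ℕ) .{{_ : NonZero n}} where
  OnDiagonal : ℕ → ℕ → ℕ → Set
  OnDiagonal ℓ i j = ∃ λ q → i + ℓ ≡ j + q * n

  onDiagonal-unique : ∀ {ℓ ℓ′ i j} → ℓ < n → ℓ′ < n → OnDiagonal ℓ i j → OnDiagonal ℓ′ i j → ℓ ≡ ℓ′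
  onDiagonal-unique {ℓ} {ℓ′} {i} {j} ℓ<n ℓ′<n (q , i+ℓ≡j+qn) (q′ , i+ℓ′≡j+q′n) =
    remainder-unique {n} q′ q ℓ<n ℓ′<n (differences-≡ {i} {ℓ} {j} {q * n} {ℓ′} {q′ * n} i+ℓ≡j+qn i+ℓ′≡j+q′n)

  shift : Fin n → Fin n → Fin n
  shift i ℓ = (toℕ i + toℕ ℓ) mod n

  onDiagonal-shift : ∀ i ℓ → OnDiagonal (toℕ ℓ) (toℕ i) (toℕ (shift i ℓ))
  onDiagonal-shift i ℓ = (toℕ i + toℕ ℓ) / n ,
    ≡.trans (m≡m%n+[m/n]*n (toℕ i + toℕ ℓ) n) (≡.cong (_+ (toℕ i + toℕ ℓ) / n * n) (≡.sym (Fin.toℕ-fromℕ< _)))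

  shift-injective : ∀ i {ℓ ℓ′} → shift i ℓ ≡ shift i ℓ′ → ℓ ≡ ℓ′
  shift-injective i {ℓ} {ℓ′} shift≡ = Fin.toℕ-injective (onDiagonal-unique (Fin.toℕ<n ℓ) (Fin.toℕ<n ℓ′)
    (onDiagonal-shift i ℓ) (≡.subst (OnDiagonal (toℕ ℓ′) (toℕ i) ∘ toℕ) (≡.sym shift≡) (onDiagonal-shift i ℓ′)))

  shift-comm : ∀ i ℓ → shift i ℓ ≡ shift ℓ i
  shift-comm i ℓ = ≡.cong (_mod n) (+-comm (toℕ i) (toℕ ℓ))

  private
    shift-surjective : ∀ i j → ∃ λ ℓ → shift i ℓ ≡ j
    shift-surjective i = FiniteSetoid.Enumerated.injective⇒surjective (≡.setoid (Fin n))
      (id , id , λ k → k , ≡.refl) ≤-refl (shift-injective i)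

  -- The diagonal through (i , j): shift i is injective, hence onto. It is only used through shift-diagonal.
  opaque
    diagonal : Fin n → Fin n → Fin n
    diagonal i j = proj₁ (shift-surjective i j)

    shift-diagonal : ∀ i j → shift i (diagonal i j) ≡ j
    shift-diagonal i j = proj₂ (shift-surjective i j)

  diagonal-shift : ∀ i ℓ → diagonal i (shift i ℓ) ≡ ℓ
  diagonal-shift i ℓ = shift-injective i (shift-diagonal i (shift i ℓ))

  diagonal-involutive : ∀ i j → diagonal (diagonal i j) j ≡ i
  diagonal-involutive i j = shift-injective (diagonal i j)
    (≡.trans (shift-diagonal (diagonal i j) j) (≡.trans (≡.sym (shift-diagonal i j)) (shift-comm i (diagonal i j))))

  onDiagonal-diagonal : ∀ i j → OnDiagonal (toℕ (diagonal i j)) (toℕ i) (toℕ j)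
  onDiagonal-diagonal i j =
    ≡.subst (OnDiagonal (toℕ (diagonal i j)) (toℕ i) ∘ toℕ) (shift-diagonal i j) (onDiagonal-shift i (diagonal i j))

  first : Fin n
  first = fromℕ< (>-nonZero⁻¹ n)

  inDiagonals⇒< : ∀ {k i j} → k ≤ n → InDiagonals n k first i j → toℕ (diagonal i j) < k
  inDiagonals⇒< {k} {i} {j} k≤n (ℓ , ℓ<k , q , i+0+ℓ≡j+qn) = ≡.subst (_< k) ℓ≡diagonal ℓ<k
    where
    ℓ≡diagonal = onDiagonal-unique (<-≤-trans ℓ<k k≤n) (Fin.toℕ<n (diagonal i j))
      (q , ≡.trans (≡.cong (_+ ℓ) (≡.sym i+0≡i)) i+0+ℓ≡j+qn) (onDiagonal-diagonal i j)
      where i+0≡i = ≡.trans (≡.cong (toℕ i +_) (Fin.toℕ-fromℕ< _)) (+-identityʳ (toℕ i))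

  <⇒inDiagonals : ∀ {k i j} → toℕ (diagonal i j) < k → InDiagonals n k first i j
  <⇒inDiagonals {k} {i} {j} diagonal<k = toℕ (diagonal i j) , diagonal<k , q ,
    ≡.trans (≡.cong (λ m → m + toℕ (diagonal i j)) i+0≡i) i+ℓ≡j+qn
    where
    q = proj₁ (onDiagonal-diagonal i j)
    i+ℓ≡j+qn = proj₂ (onDiagonal-diagonal i j)
    i+0≡i = ≡.trans (≡.cong (toℕ i +_) (Fin.toℕ-fromℕ< _)) (+-identityʳ (toℕ i))

  module DiagonalSums {c ℓ} (M : CommutativeMonoid c ℓ) where
    open CommutativeMonoid M
    open import Algebra.Properties.CommutativeMonoid.Sum M using (sum; sum-permute; sum-cong-≗)
    open import Relation.Binary.Reasoning.Setoid setoid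

    sum-reindex : ∀ {σ τ : Fin n → Fin n} → (∀ k → σ (τ k) ≡ k) → (∀ k → τ (σ k) ≡ k) → ∀ h → sum (h ∘ σ) ≈ sum h
    sum-reindex στ τσ h = sym (sum-permute h (permutation _ _ στ τσ))

    row-sum : ∀ i (h : Fin n → Carrier) → sum (λ j → h (diagonal i j)) ≈ sum h
    row-sum i = sum-reindex (diagonal-shift i) (shift-diagonal i)

    column-sum : ∀ j (F : Fin n → Fin n → Carrier) → sum (λ i → F i (diagonal i j)) ≈ sum (λ ℓ → F (diagonal ℓ j) ℓ)
    column-sum j F = begin
      sum (λ i → F i (diagonal i j))
        ≡⟨ sum-cong-≗ (λ i → ≡.cong (λ r → F r (diagonal i j)) (diagonal-involutive i j)) ⟨
      sum (λ i → F (diagonal (diagonal i j) j) (diagonal i j))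
        ≈⟨ sum-reindex (λ ℓ → diagonal-involutive ℓ j) (λ i → diagonal-involutive i j) _ ⟩
      sum (λ ℓ → F (diagonal ℓ j) ℓ)
        ∎

-- Diagonal ℓ < 2 b of a row holds the even (false) or odd (true) member of the pair ⌊ℓ / 2⌋.
pairIndex : ∀ b → ℕ → Maybe (Fin b × Bool)
pairIndex zero    _             = nothing
pairIndex (suc b) zero          = just (zero , false)
pairIndex (suc b) (suc zero)    = just (zero , true)
pairIndex (suc b) (suc (suc ℓ)) = Maybe.map (map₁ suc) (pairIndex b ℓ)

pairIndex-just⇒< : ∀ b ℓ {x} → pairIndex b ℓ ≡ just x → ℓ < 2 * b
pairIndex-just⇒< (suc b) zero          _ = ≡.subst (0 <_) (≡.sym (*-suc 2 b)) z<s
pairIndex-just⇒< (suc b) (suc zero)    _ = ≡.subst (1 <_) (≡.sym (*-suc 2 b)) (s≤s (s≤s z≤n))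
pairIndex-just⇒< (suc b) (suc (suc ℓ)) eq with pairIndex b ℓ in eq′
... | just _ = ≡.subst (suc (suc ℓ) <_) (≡.sym (*-suc 2 b)) (s≤s (s≤s (pairIndex-just⇒< b ℓ eq′)))

<⇒pairIndex-just : ∀ b ℓ → ℓ < 2 * b → ∃ λ x → pairIndex b ℓ ≡ just x
<⇒pairIndex-just (suc b) zero          _ = _ , ≡.refl
<⇒pairIndex-just (suc b) (suc zero)    _ = _ , ≡.refl
<⇒pairIndex-just (suc b) (suc (suc ℓ)) ℓ<2b with ≡.subst (suc (suc ℓ) <_) (*-suc 2 b) ℓ<2b
... | s≤s (s≤s ℓ<2b′) with <⇒pairIndex-just b ℓ ℓ<2b′
... | x , eq = map₁ suc x , ≡.cong (Maybe.map (map₁ suc)) eq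

pairIndex-surjective : ∀ b x → ∃ λ ℓ → pairIndex b ℓ ≡ just x
pairIndex-surjective (suc b) (zero , false) = 0 , ≡.refl
pairIndex-surjective (suc b) (zero , true)  = 1 , ≡.refl
pairIndex-surjective (suc b) (suc p , e) with pairIndex-surjective b (p , e)
... | ℓ , eq = suc (suc ℓ) , ≡.cong (Maybe.map (map₁ suc)) eq

position : ∀ {b} → Fin b × Bool → ℕ
position (p , false) = 2 * toℕ p
position (p , true)  = suc (2 * toℕ p)

position-suc : ∀ {b} (p : Fin b) e → position (suc p , e) ≡ suc (suc (position (p , e)))
position-suc p false = *-suc 2 (toℕ p)
position-suc p true  = ≡.cong suc (*-suc 2 (toℕ p))

pairIndex⇒position : ∀ b ℓ {x} → pairIndex b ℓ ≡ just x → ℓ ≡ position x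
pairIndex⇒position (suc b) zero          ≡.refl = ≡.refl
pairIndex⇒position (suc b) (suc zero)    ≡.refl = ≡.refl
pairIndex⇒position (suc b) (suc (suc ℓ)) eq with pairIndex b ℓ in eq′
pairIndex⇒position (suc b) (suc (suc ℓ)) ≡.refl | just (p , e) =
  ≡.trans (≡.cong (λ k → suc (suc k)) (pairIndex⇒position b ℓ eq′)) (≡.sym (position-suc p e))

module PairedSum {c ℓ} (M : Monoid c ℓ) where
  open Monoid M
  open Sum M using (sum; sum-cong-≋; sum-replicate-zero)
  open Mult M using () renaming (_×_ to _×ₘ_)
  open import Relation.Binary.Reasoning.Setoid setoid

  sum-paired : ∀ b {n} (h : Fin n → Carrier) {a} → 2 * b ≤ n →
               (∀ ℓ → pairIndex b (toℕ ℓ) ≡ nothing → h ℓ ≈ ε) →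
               (∀ ℓ ℓ′ {p} → pairIndex b (toℕ ℓ) ≡ just (p , false) → pairIndex b (toℕ ℓ′) ≡ just (p , true) →
                 h ℓ ∙ h ℓ′ ≈ a) →
               sum h ≈ b ×ₘ a
  sum-paired zero {n} h _ unpaired _ = trans (sum-cong-≋ (λ ℓ → unpaired ℓ ≡.refl)) (sum-replicate-zero n)
  sum-paired (suc b) {n} h {a} 2b≤n unpaired paired with ≡.subst (_≤ n) (*-suc 2 b) 2b≤n
  ... | s≤s (s≤s 2b≤n′) = begin
    h zero ∙ (h (suc zero) ∙ sum h″)  ≈⟨ assoc _ _ _ ⟨
    h zero ∙ h (suc zero) ∙ sum h″    ≈⟨ ∙-cong (paired zero (suc zero) ≡.refl ≡.refl)
                                          (sum-paired b h″ 2b≤n′ unpaired′ paired′) ⟩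
    a ∙ b ×ₘ a                        ∎
    where
    h″ = λ ℓ → h (suc (suc ℓ))
    shifted = ≡.cong (Maybe.map (map₁ suc))
    unpaired′ = λ ℓ eq → unpaired (suc (suc ℓ)) (shifted eq)
    paired′ = λ ℓ ℓ′ {p} eq eq′ → paired (suc (suc ℓ)) (suc (suc ℓ′)) (shifted eq) (shifted eq′)

module Construction {a ℓ} (G : AbelianGroup a ℓ) {g n} (g-order : ElementOrder G g n) {b c} (2b≤n : 2 * b ≤ n)
                    {s} {U : Fin (c * b) → AbelianGroup.Carrier G}
                    (avoiding : EvenOrder.SumAvoiding (Cyclic.quotient G g-order) s U) where
  open AbelianGroup G
  open import Algebra.Properties.AbelianGroup G
  open import Algebra.Properties.CommutativeSemigroup commutativeSemigroup using (x∙yz≈y∙xz)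
  open Iterated G
  open Cyclic G g-order

  private instance
    n-nonZero : NonZero n
    n-nonZero = >-nonZero (proj₁ g-order)

  open Diagonals n
  open import Relation.Binary.Reasoning.Setoid setoid

  -- (array, pair, parity, row); the odd member of a pair is its partner s - x.
  Cell : Set
  Cell = Fin c × Fin b × Bool × Fin n

  value : Cell → Carrier
  value (x , p , false , i) = U (combine x p) ∙ toℕ i · g
  value (x , p , true  , i) = s - (U (combine x p) ∙ toℕ i · g)

  private
    translate~ : ∀ k r → U k ∙ r · g ~ U k
    translate~ k r = x∙h~x (U k) (r , refl)

    even-injective : ∀ {k k′} r r′ → r < n → r′ < n → U k ∙ r · g ≈ U k′ ∙ r′ · g → k ≡ k′ × r ≡ r′
    even-injective {k} {k′} r r′ r<n r′<n eq
      with proj₁ avoiding (~-trans (~-sym (translate~ k r)) (~-trans (≈⇒~ eq) (translate~ k′ r′)))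
    ... | ≡.refl = ≡.refl , ·-injective r<n r′<n (∙-cancelˡ (U k) _ _ eq)

    even≉odd : ∀ k k′ r r′ → ¬ U k ∙ r · g ≈ s - (U k′ ∙ r′ · g)
    even≉odd k k′ r r′ eq = proj₂ avoiding k k′
      (~-trans (∙-cong~ (~-sym (translate~ k r)) (~-sym (translate~ k′ r′)))
               (≈⇒~ (trans (∙-congʳ eq) (//-rightDividesˡ _ s))))

    cell-≡ : ∀ {x x′ : Fin c} {p p′ : Fin b} {i i′ : Fin n} e → combine x p ≡ combine x′ p′ → toℕ i ≡ toℕ i′ →
             _≡_ {A = Cell} (x , p , e , i) (x′ , p′ , e , i′)
    cell-≡ {x} {x′} {p} {p′} e combine≡ toℕ≡ with Fin.combine-injective x p x′ p′ combine≡ | Fin.toℕ-injective toℕ≡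
    ... | ≡.refl , ≡.refl | ≡.refl = ≡.refl

  value-injective : Injective _≡_ _≈_ value
  value-injective {_ , _ , false , i} {_ , _ , false , i′} eq =
    let k≡k′ , r≡r′ = even-injective (toℕ i) (toℕ i′) (Fin.toℕ<n i) (Fin.toℕ<n i′) eq
    in cell-≡ false k≡k′ r≡r′
  value-injective {_ , _ , true , i} {_ , _ , true , i′} eq =
    let k≡k′ , r≡r′ = even-injective (toℕ i) (toℕ i′) (Fin.toℕ<n i) (Fin.toℕ<n i′)
                        (⁻¹-injective (∙-cancelˡ s _ _ eq))
    in cell-≡ true k≡k′ r≡r′
  value-injective {x , p , false , i} {x′ , p′ , true , i′} eq =
    ⊥-elim (even≉odd (combine x p) (combine x′ p′) (toℕ i) (toℕ i′) eq)
  value-injective {x , p , true , i} {x′ , p′ , false , i′} eq =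
    ⊥-elim (even≉odd (combine x′ p′) (combine x p) (toℕ i′) (toℕ i) (sym eq))

  entry : Fin c → Fin n → Fin b × Bool → Carrier
  entry x i (p , e) = value (x , p , e , i)

  array : Fin c → Fin n → Fin n → Maybe Carrier
  array x i j = Maybe.map (entry x i) (pairIndex b (toℕ (diagonal i j)))

  module ArraySums {c′ ℓ′} (M : CommutativeMonoid c′ ℓ′) (φ : Maybe Carrier → CommutativeMonoid.Carrier M)
                   (φ-nothing : CommutativeMonoid._≈_ M (φ nothing) (CommutativeMonoid.ε M)) where
    private module M = CommutativeMonoid M
    open import Algebra.Properties.CommutativeMonoid.Sum M using (sum)
    open Mult M.monoid using () renaming (_×_ to _×ₘ_)
    open PairedSum M.monoid
    open DiagonalSums M

    private
      weight : Fin c → Fin n → Maybe (Fin b × Bool) → M.Carrier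
      weight x i = φ ∘ Maybe.map (entry x i)

      weight-≡ : ∀ x i {ℓ m} → pairIndex b ℓ ≡ m → weight x i (pairIndex b ℓ) M.≈ weight x i m
      weight-≡ x i = M.reflexive ∘ ≡.cong (weight x i)

    row-sum-paired : ∀ x i {w} → (∀ p → weight x i (just (p , false)) M.∙ weight x i (just (p , true)) M.≈ w) →
                     sum (λ j → φ (array x i j)) M.≈ b ×ₘ w
    row-sum-paired x i pair = M.trans (row-sum i _) (sum-paired b _ 2b≤n
      (λ ℓ eq → M.trans (weight-≡ x i eq) φ-nothing)
      (λ ℓ ℓ′ {p} eq eq′ → M.trans (M.∙-cong (weight-≡ x i eq) (weight-≡ x i eq′)) (pair p)))

    column-sum-paired : ∀ x j {w} →
      (∀ ℓ ℓ′ p → toℕ ℓ′ ≡ suc (toℕ ℓ) →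
        weight x (diagonal ℓ j) (just (p , false)) M.∙ weight x (diagonal ℓ′ j) (just (p , true)) M.≈ w) →
      sum (λ i → φ (array x i j)) M.≈ b ×ₘ w
    column-sum-paired x j pair = M.trans (column-sum j λ i ℓ → weight x i (pairIndex b (toℕ ℓ)))
      (sum-paired b _ 2b≤n
      (λ ℓ eq → M.trans (weight-≡ x (diagonal ℓ j) eq) φ-nothing)
      (λ ℓ ℓ′ {p} eq eq′ → M.trans (M.∙-cong (weight-≡ x (diagonal ℓ j) eq) (weight-≡ x (diagonal ℓ′ j) eq′))
        (pair ℓ ℓ′ p (≡.trans (pairIndex⇒position b _ eq′) (≡.cong suc (≡.sym (pairIndex⇒position b _ eq)))))))

  private
    partner-sum : ∀ y → y ∙ (s - y) ≈ s
    partner-sum y = trans (comm y (s - y)) (//-rightDividesˡ y s)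

    shifted-partner-sum : ∀ y → g ∙ y ∙ (s - y) ≈ s ∙ g
    shifted-partner-sum y = trans (assoc g y (s - y)) (trans (∙-congˡ (partner-sum y)) (comm g s))

    -- Consecutive diagonals of column j pass through consecutive rows.
    row-step : ∀ j ℓ ℓ′ → toℕ ℓ′ ≡ suc (toℕ ℓ) → toℕ (diagonal ℓ j) · g ≈ g ∙ toℕ (diagonal ℓ′ j) · g
    row-step j ℓ ℓ′ ℓ′≡1+ℓ = ·-≡-mod {r} {q′} {suc r′} {q}
      (differences-≡ {toℕ ℓ} {r} {toℕ j} {q * n} {suc r′} {q′ * n} ℓ+r≡j+qn
        (≡.trans (+-suc (toℕ ℓ) r′) (≡.trans (≡.cong (_+ r′) (≡.sym ℓ′≡1+ℓ)) ℓ′+r′≡j+q′n)))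
      where
      r = toℕ (diagonal ℓ j)
      r′ = toℕ (diagonal ℓ′ j)
      q = proj₁ (onDiagonal-diagonal ℓ j)
      ℓ+r≡j+qn = proj₂ (onDiagonal-diagonal ℓ j)
      q′ = proj₁ (onDiagonal-diagonal ℓ′ j)
      ℓ′+r′≡j+q′n = proj₂ (onDiagonal-diagonal ℓ′ j)

  open ArraySums commutativeMonoid (fromMaybe ε) refl
    renaming (row-sum-paired to row-∑; column-sum-paired to column-∑)
  open ArraySums +-0-commutativeMonoid (λ h → if is-just h then 1 else 0) ≡.refl
    renaming (row-sum-paired to row-count; column-sum-paired to column-count)

  open Mult monoid using () renaming (_×_ to _×ₘ_)

  rowSum : ∀ x i → ∑ G n (λ j → fromMaybe ε (array x i j)) ≈ b ×ₘ s
  rowSum x i = trans (reflexive (∑≡sum n _)) (row-∑ x i λ p → partner-sum _)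

  colSum : ∀ x j → ∑ G n (λ i → fromMaybe ε (array x i j)) ≈ b ×ₘ (s ∙ g)
  colSum x j = trans (reflexive (∑≡sum n _)) (column-∑ x j λ ℓ ℓ′ p ℓ′≡1+ℓ →
    trans (∙-congʳ (trans (∙-congˡ (row-step j ℓ ℓ′ ℓ′≡1+ℓ)) (x∙yz≈y∙xz _ g _))) (shifted-partner-sum _))

  rowCount : ∀ x i → countTrue n (λ j → is-just (array x i j)) ≡ 2 * b
  rowCount x i =
    ≡.trans (sumℕ≡sum n _) (≡.trans (row-count x i λ _ → ≡.refl) (≡.trans (×≡* b 2) (*-comm b 2)))

  colCount : ∀ x j → countTrue n (λ i → is-just (array x i j)) ≡ 2 * b
  colCount x j =
    ≡.trans (sumℕ≡sum n _) (≡.trans (column-count x j λ _ _ _ _ → ≡.refl) (≡.trans (×≡* b 2) (*-comm b 2)))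

  filled⇒< : ∀ {x i j} → (Σ Carrier λ h → array x i j ≡ just h) → toℕ (diagonal i j) < 2 * b
  filled⇒< {x} {i} {j} (h , array≡just) with pairIndex b (toℕ (diagonal i j)) in eq
  ... | just _ = pairIndex-just⇒< b _ eq

  <⇒filled : ∀ {x i j} → toℕ (diagonal i j) < 2 * b → Σ Carrier λ h → array x i j ≡ just h
  <⇒filled {x} {i} {j} diagonal<2b = _ , map-just (proj₂ (<⇒pairIndex-just b _ diagonal<2b))

  unique : ∀ x i j x′ i′ j′ h h′ → array x i j ≡ just h → array x′ i′ j′ ≡ just h′ → h ≈ h′ →
           x ≡ x′ × i ≡ i′ × j ≡ j′
  unique x i j x′ i′ j′ h h′ array≡h array′≡h′ h≈h′
    with pairIndex b (toℕ (diagonal i j)) in eq | pairIndex b (toℕ (diagonal i′ j′)) in eq′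
  unique x i j x′ i′ j′ _ _ ≡.refl ≡.refl h≈h′ | just (p , e) | just (p′ , e′)
    with value-injective {x , p , e , i} {x′ , p′ , e′ , i′} h≈h′
  ... | ≡.refl = ≡.refl , ≡.refl , j≡j′
    where
    j≡j′ = ≡.trans (≡.sym (shift-diagonal i j)) (≡.trans (≡.cong (shift i) (Fin.toℕ-injective
      (≡.trans (pairIndex⇒position b _ eq) (≡.sym (pairIndex⇒position b _ eq′))))) (shift-diagonal i j′))

  module _ {N} (enumeration : FiniteSetoid.Enumeration setoid N) (N≡ : N ≡ c * (b * (2 * n))) where
    open FiniteSetoid setoid using (reindex)
    open FiniteSetoid.Enumerated setoid enumeration using (injective⇒surjective)

    cells : Fin (c * (b * (2 * n))) ↔ Cell
    cells = ↔-trans Fin.*↔× (↔-refl ×-↔ ↔-trans Fin.*↔× (↔-refl ×-↔ ↔-trans Fin.*↔× (Fin.2↔Bool ×-↔ ↔-refl)))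

    covers : ∀ z → Σ (Fin c) λ x → Σ (Fin n) λ i → Σ (Fin n) λ j → Σ Carrier λ h → array x i j ≡ just h × h ≈ z
    covers z with injective⇒surjective (≤-reflexive N≡) (reindex cells value-injective) z
    ... | k , value≈z with Inverse.to cells k
    ... | x , p , e , i = x , i , shift i d , value (x , p , e , i) , array≡value , value≈z
      where
      ℓ,pairIndex≡ = pairIndex-surjective b (p , e)
      d : Fin n
      d = fromℕ< (<-≤-trans (pairIndex-just⇒< b _ (proj₂ ℓ,pairIndex≡)) 2b≤n)
      array≡value : array x i (shift i d) ≡ just (value (x , p , e , i))
      array≡value = ≡.trans (≡.cong (λ k → Maybe.map (entry x i) (pairIndex b (toℕ k))) (diagonal-shift i d))
        (≡.trans (≡.cong (λ k → Maybe.map (entry x i) (pairIndex b k)) (Fin.toℕ-fromℕ< _))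
          (map-just (proj₂ ℓ,pairIndex≡)))

    diagonalMRS : DiagonalMRS G n (2 * b) c
    diagonalMRS = array , record
      { covers = covers ; unique = unique ; rowCount = rowCount ; colCount = colCount
      ; ω = b ×ₘ s ; δ = b ×ₘ (s ∙ g) ; rowSum = rowSum ; colSum = colSum }
      , λ x → first , λ i j → <⇒inDiagonals ∘ filled⇒< , <⇒filled ∘ inDiagonals⇒< 2b≤n

-- The proof uses none of the positivity hypotheses.
corollary5p7 : ∀ {a ℓ : Level} (G : AbelianGroup a ℓ) (b n c : ℕ) →
    1 ≤ b → 1 ≤ n → 1 ≤ c → 2 ≤ 2 * b → 2 * b ≤ n →
    HasOrder G (2 * n * b * c) →
    ((∃ λ g → ElementOrder G g n) → DiagonalMRS G n (2 * b) c) ×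
    (∀ e → IsExponent G e → n ∣ e → DiagonalMRS G n (2 * b) c)
corollary5p7 G b n c _ _ _ _ 2b≤n (e , e-injective , e-surjective) =
  diagonalMRS , λ _ exponent n∣e → diagonalMRS (Exponent.∃-order G enumeration exponent n∣e)
  where
  enumeration : FiniteSetoid.Enumeration (AbelianGroup.setoid G) (2 * n * b * c)
  enumeration = e , (λ {i} {j} → e-injective i j) , e-surjective
  |G|≡2cb*n : ∀ n b c → 2 * n * b * c ≡ (c * b + c * b) * n
  |G|≡2cb*n = solve-∀
  |G|≡cells : ∀ n b c → 2 * n * b * c ≡ c * (b * (2 * n))
  |G|≡cells = solve-∀
  diagonalMRS : (∃ λ g → ElementOrder G g n) → DiagonalMRS G n (2 * b) c
  diagonalMRS (g , g-order) =
    let s , U , avoiding = EvenOrder.∃-sumAvoiding (Cyclic.quotient G g-order)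
                             (Cyclic.quotient-enumeration G g-order enumeration (|G|≡2cb*n n b c))
    in Construction.diagonalMRS G g-order 2b≤n avoiding enumeration (|G|≡cells n b c)
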